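{- For every instance and every work-conserving schedule $\mathcal{S}$, \[ F(\mathcal{OPT})\;\ge\;\sum_{i=1}^n\sum_{k=1}^{p_i} f_{i,k}(\mathcal{S}). \]
   Context: A single machine and $n$ jobs; job $J_i$ has integer release time $r_i\ge0$ and integer processing time $p_i\ge1$. Unit slots $[t]=[t,t+1)$, $t\in\mathbb{N}$. A schedule $\mathcal{S}$ assigns each slot to at most one job, $J_i$ receiving exactly $p_i$ slots all with $t\ge r_i$. View $J_i$ as unit tasks $J_{i,1},\dots,J_{i,p_i}$: the $k$-th slot assigned to $J_i$ executes $J_{i,k}$, and if this slot is $[t]$ then $c_{i,k}(\mathcal{S})=t+1$; $f_{i,k}(\mathcal{S})=c_{i,k}(\mathcal{S})-r_i$. $c_i(\mathcal{S})=c_{i,p_i}(\mathcal{S})$, $f_i(\mathcal{S})=c_i(\mathcal{S})-r_i$, $F(\mathcal{S})=\sum_i f_i(\mathcal{S})^2$, and $\mathcal{OPT}$ minimizes $F$. $J_i$ is active at $t$ if $r_i\le t<c_i(\mathcal{S})$; $\mathcal{S}$ is work-conserving if for every $t$, whenever some job is active at $t$, slot $[t]$ is assigned to some job. -}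

module Defs where

open import Data.Nat using (ℕ; zero; suc; _+_; _*_; _∸_; _≤_; _<_)
open import Data.Fin using (Fin)
import Data.Fin as Fin
open import Data.Maybe using (Maybe; just; nothing)
open import Data.Bool using (Bool; true; false; if_then_else_; _∧_)
open import Data.List using (List; map; allFin)
open import Data.Nat.ListAction using (sum)
open import Data.Nat using (_≡ᵇ_)
open import Relation.Nullary.Decidable using (⌊_⌋)
open import Relation.Binary.PropositionalEquality using (_≡_; _≢_)
open import Data.Product using (∃; _×_)

record Instance : Set where
  field
    n     : ℕ
    r     : Fin n → ℕ
    p     : Fin n → ℕ
    p≥1   : ∀ i → 1 ≤ p i
open Instance public

Σ[_] : (n : ℕ) → (Fin n → ℕ) → ℕ
Σ[ n ] f = sum (map f (allFin n))

Σ₁ : ℕ → (ℕ → ℕ) → ℕ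
Σ₁ zero    f = 0
Σ₁ (suc m) f = Σ₁ m f + f (suc m)

isJob : ∀ {n} → Maybe (Fin n) → Fin n → Bool
isJob nothing  i = false
isJob (just j) i = ⌊ j Fin.≟ i ⌋

count : ∀ {n} → (ℕ → Maybe (Fin n)) → Fin n → ℕ → ℕ
count s i zero    = 0
count s i (suc T) = count s i T + (if isJob (s T) i then 1 else 0)

record Schedule (I : Instance) : Set where
  field
    slot     : ℕ → Maybe (Fin (n I))
    horizon  : ℕ
    idleAfter : ∀ t → horizon ≤ t → slot t ≡ nothing
    released : ∀ t i → slot t ≡ just i → r I i ≤ t
    exact    : ∀ i → count slot i horizon ≡ p I i
open Schedule public

-- first t in [from, from + fuel) satisfying P (or from + fuel if none)
search : (ℕ → Bool) → ℕ → ℕ → ℕ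
search P from zero       = from
search P from (suc fuel) = if P from then from else search P (suc from) fuel

-- the slot index t of the k-th (1-based) slot assigned to job i
kthSlot : ∀ {I} → Schedule I → Fin (n I) → ℕ → ℕ
kthSlot S i k =
  search (λ t → isJob (slot S t) i ∧ (suc (count (slot S) i t) ≡ᵇ k)) 0 (horizon S)

c_ik : ∀ {I} → Schedule I → Fin (n I) → ℕ → ℕ
c_ik S i k = suc (kthSlot S i k)

f_ik : ∀ {I} → Schedule I → Fin (n I) → ℕ → ℕ
f_ik {I} S i k = c_ik S i k ∸ r I i

c_i : ∀ {I} → Schedule I → Fin (n I) → ℕ
c_i {I} S i = c_ik S i (p I i)

f_i : ∀ {I} → Schedule I → Fin (n I) → ℕ
f_i {I} S i = c_i S i ∸ r I i

F : ∀ {I} → Schedule I → ℕ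
F {I} S = Σ[ n I ] (λ i → f_i S i * f_i S i)

IsOptimal : ∀ {I} → Schedule I → Set
IsOptimal {I} O = ∀ (S : Schedule I) → F O ≤ F S

Active : ∀ {I} → Schedule I → Fin (n I) → ℕ → Set
Active {I} S i t = r I i ≤ t × t < c_i S i

WorkConserving : ∀ {I} → Schedule I → Set
WorkConserving {I} S = ∀ t → (∃ λ i → Active S i t) → slot S t ≢ nothing

sumUnitFlow : ∀ {I} → Schedule I → ℕ
sumUnitFlow {I} S = Σ[ n I ] (λ i → Σ₁ (p I i) (f_ik S i))

{-# OPTIONS --safe #-}
module Submission where

-- Unit k of J_i is still pending at time t exactly when t < c_{i,k}, so Σ_k c_{i,k} counts the
-- pairs (t, pending unit of J_i at t), and Σ_{i,k} c_{i,k} is the remaining work summed over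
-- all times t.  A work-conserving schedule S is idle only when every released job is finished,
-- so by induction on t it has processed at least as much work as any schedule O: its remaining
-- work is pointwise smallest.  Subtracting Σ_i p_i r_i from both sides compares the unit flows,
-- and f_{i,k}(O) ≤ f_i(O) together with p_i ≤ f_i(O) bounds Σ_k f_{i,k}(O) by f_i(O)².

open import Defs
open import Data.Nat
  using (ℕ; zero; suc; _+_; _*_; _∸_; _⊓_; _≤_; _<_; z≤n; s≤s; z<s; _≤?_; _<?_; _≡ᵇ_)
open import Data.Nat.Properties
open import Algebra.Properties.CommutativeSemigroup +-commutativeSemigroup using (interchange)
open import Data.Fin using (Fin)
import Data.Fin as Fin
open import Data.Maybe using (Maybe; just; nothing)
open import Data.Bool using (Bool; true; false; if_then_else_; _∧_; T)
open import Data.Bool.Properties using (T-≡; T-∧)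
open import Data.List using (List; []; _∷_; map; allFin)
open import Data.List.Properties using (map-cong; map-tabulate)
open import Data.Nat.ListAction using (sum)
open import Data.Product using (_×_; _,_; proj₁; proj₂; ∃-syntax)
open import Data.Sum using (_⊎_; inj₁; inj₂)
open import Data.Empty using (⊥-elim)
open import Function using (_∘_)
open import Function.Bundles using (_⇔_; mk⇔; Equivalence)
open import Relation.Nullary using (yes; no; contradiction)
open import Relation.Nullary.Decidable using (toWitness; isYes≗does; dec-true; ⌊⌋-map′)
open import Relation.Binary.PropositionalEquality

Σ< : ℕ → (ℕ → ℕ) → ℕ
Σ< zero    f = 0
Σ< (suc M) f = Σ< M f + f M

Σ<-cong : ∀ M {f g : ℕ → ℕ} → f ≗ g → Σ< M f ≡ Σ< M g
Σ<-cong zero    f≗g = refl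
Σ<-cong (suc M) f≗g = cong₂ _+_ (Σ<-cong M f≗g) (f≗g M)

Σ<-mono-≤ : ∀ M {f g : ℕ → ℕ} → (∀ t → f t ≤ g t) → Σ< M f ≤ Σ< M g
Σ<-mono-≤ zero    f≤g = z≤n
Σ<-mono-≤ (suc M) f≤g = +-mono-≤ (Σ<-mono-≤ M f≤g) (f≤g M)

Σ<-zero : ∀ M → Σ< M (λ _ → 0) ≡ 0
Σ<-zero zero    = refl
Σ<-zero (suc M) = cong (_+ 0) (Σ<-zero M)

Σ<-distrib-+ : ∀ M (f g : ℕ → ℕ) → Σ< M (λ t → f t + g t) ≡ Σ< M f + Σ< M g
Σ<-distrib-+ zero    f g = refl
Σ<-distrib-+ (suc M) f g =
  trans (cong (_+ (f M + g M)) (Σ<-distrib-+ M f g)) (interchange (Σ< M f) (Σ< M g) (f M) (g M))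

𝟙< : ℕ → ℕ → ℕ
𝟙< x       zero    = 0
𝟙< zero    (suc k) = 1
𝟙< (suc x) (suc k) = 𝟙< x k

𝟙<-≡1 : ∀ {x k} → x < k → 𝟙< x k ≡ 1
𝟙<-≡1 {zero}  {suc k} _         = refl
𝟙<-≡1 {suc x} {suc k} (s≤s x<k) = 𝟙<-≡1 x<k

𝟙<-≡0 : ∀ {x k} → k ≤ x → 𝟙< x k ≡ 0
𝟙<-≡0 {x}     {zero}  _         = refl
𝟙<-≡0 {suc x} {suc k} (s≤s k≤x) = 𝟙<-≡0 k≤x

Σ<-𝟙< : ∀ M c → Σ< M (λ t → 𝟙< t c) ≡ M ⊓ c
Σ<-𝟙< zero    c = refl
Σ<-𝟙< (suc M) c with M <? c
... | yes M<c = begin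
  Σ< M (λ t → 𝟙< t c) + 𝟙< M c ≡⟨ cong₂ _+_ (Σ<-𝟙< M c) (𝟙<-≡1 M<c) ⟩
  M ⊓ c + 1                     ≡⟨ cong (_+ 1) (m≤n⇒m⊓n≡m (<⇒≤ M<c)) ⟩
  M + 1                         ≡⟨ +-comm M 1 ⟩
  suc M                         ≡⟨ sym (m≤n⇒m⊓n≡m M<c) ⟩
  suc M ⊓ c                     ∎
  where open ≡-Reasoning
... | no M≮c = begin
  Σ< M (λ t → 𝟙< t c) + 𝟙< M c ≡⟨ cong₂ _+_ (Σ<-𝟙< M c) (𝟙<-≡0 c≤M) ⟩
  M ⊓ c + 0                     ≡⟨ +-identityʳ (M ⊓ c) ⟩
  M ⊓ c                         ≡⟨ m≥n⇒m⊓n≡n c≤M ⟩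
  c                             ≡⟨ sym (m≥n⇒m⊓n≡n (m≤n⇒m≤1+n c≤M)) ⟩
  suc M ⊓ c                     ∎
  where
  open ≡-Reasoning
  c≤M = ≮⇒≥ M≮c

Σ₁-cong : ∀ q {f g : ℕ → ℕ} → (∀ {k} → 1 ≤ k → k ≤ q → f k ≡ g k) → Σ₁ q f ≡ Σ₁ q g
Σ₁-cong zero    f≡g = refl
Σ₁-cong (suc q) f≡g =
  cong₂ _+_ (Σ₁-cong q (λ 1≤k k≤q → f≡g 1≤k (m≤n⇒m≤1+n k≤q))) (f≡g (s≤s z≤n) ≤-refl)

Σ₁-mono-≤ : ∀ q {f g : ℕ → ℕ} → (∀ {k} → 1 ≤ k → k ≤ q → f k ≤ g k) → Σ₁ q f ≤ Σ₁ q g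
Σ₁-mono-≤ zero    f≤g = z≤n
Σ₁-mono-≤ (suc q) f≤g =
  +-mono-≤ (Σ₁-mono-≤ q (λ 1≤k k≤q → f≤g 1≤k (m≤n⇒m≤1+n k≤q))) (f≤g (s≤s z≤n) ≤-refl)

Σ₁-distrib-+ : ∀ q (f g : ℕ → ℕ) → Σ₁ q (λ k → f k + g k) ≡ Σ₁ q f + Σ₁ q g
Σ₁-distrib-+ zero    f g = refl
Σ₁-distrib-+ (suc q) f g =
  trans (cong (_+ (f (suc q) + g (suc q))) (Σ₁-distrib-+ q f g))
        (interchange (Σ₁ q f) (Σ₁ q g) (f (suc q)) (g (suc q)))

Σ₁-const : ∀ q c → Σ₁ q (λ _ → c) ≡ q * c
Σ₁-const zero    c = refl
Σ₁-const (suc q) c = trans (cong (_+ c) (Σ₁-const q c)) (+-comm (q * c) c)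

Σ₁-∸+ : ∀ q (g : ℕ → ℕ) c → (∀ {k} → 1 ≤ k → k ≤ q → c ≤ g k) →
        Σ₁ q (λ k → g k ∸ c) + q * c ≡ Σ₁ q g
Σ₁-∸+ q g c c≤g = begin
  Σ₁ q (λ k → g k ∸ c) + q * c             ≡⟨ cong (Σ₁ q (λ k → g k ∸ c) +_) (Σ₁-const q c) ⟨
  Σ₁ q (λ k → g k ∸ c) + Σ₁ q (λ _ → c)   ≡⟨ Σ₁-distrib-+ q (λ k → g k ∸ c) (λ _ → c) ⟨
  Σ₁ q (λ k → g k ∸ c + c)                 ≡⟨ Σ₁-cong q (λ 1≤k k≤q → m∸n+n≡m (c≤g 1≤k k≤q)) ⟩
  Σ₁ q g                                   ∎
  where open ≡-Reasoning

Σ₁-𝟙< : ∀ q x → Σ₁ q (𝟙< x) ≡ q ∸ x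
Σ₁-𝟙< zero    x = sym (0∸n≡0 x)
Σ₁-𝟙< (suc q) x with x ≤? q
... | yes x≤q = begin
  Σ₁ q (𝟙< x) + 𝟙< x (suc q) ≡⟨ cong₂ _+_ (Σ₁-𝟙< q x) (𝟙<-≡1 (s≤s x≤q)) ⟩
  q ∸ x + 1                   ≡⟨ +-comm (q ∸ x) 1 ⟩
  suc (q ∸ x)                 ≡⟨ +-∸-assoc 1 x≤q ⟨
  suc q ∸ x                   ∎
  where open ≡-Reasoning
... | no x≰q = begin
  Σ₁ q (𝟙< x) + 𝟙< x (suc q) ≡⟨ cong₂ _+_ (Σ₁-𝟙< q x) (𝟙<-≡0 q<x) ⟩
  q ∸ x + 0                   ≡⟨ cong (_+ 0) (m≤n⇒m∸n≡0 (<⇒≤ q<x)) ⟩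
  0                           ≡⟨ m≤n⇒m∸n≡0 q<x ⟨
  suc q ∸ x                   ∎
  where
  open ≡-Reasoning
  q<x = ≰⇒> x≰q

Σ₁-Σ< : ∀ q M (h : ℕ → ℕ → ℕ) → Σ₁ q (λ k → Σ< M (h k)) ≡ Σ< M (λ t → Σ₁ q (λ k → h k t))
Σ₁-Σ< zero    M h = sym (Σ<-zero M)
Σ₁-Σ< (suc q) M h = trans (cong (_+ Σ< M (h (suc q))) (Σ₁-Σ< q M h))
                          (sym (Σ<-distrib-+ M (λ t → Σ₁ q (λ k → h k t)) (h (suc q))))

module _ {A : Set} where

  sum-map-zero : ∀ (xs : List A) → sum (map (λ _ → 0) xs) ≡ 0
  sum-map-zero []       = refl
  sum-map-zero (x ∷ xs) = sum-map-zero xs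

  sum-map-distrib-+ : ∀ (xs : List A) (f g : A → ℕ) →
                      sum (map (λ x → f x + g x) xs) ≡ sum (map f xs) + sum (map g xs)
  sum-map-distrib-+ []       f g = refl
  sum-map-distrib-+ (x ∷ xs) f g =
    trans (cong (f x + g x +_) (sum-map-distrib-+ xs f g))
          (interchange (f x) (g x) (sum (map f xs)) (sum (map g xs)))

  sum-map-mono-≤ : ∀ (xs : List A) {f g : A → ℕ} → (∀ x → f x ≤ g x) → sum (map f xs) ≤ sum (map g xs)
  sum-map-mono-≤ []       f≤g = z≤n
  sum-map-mono-≤ (x ∷ xs) f≤g = +-mono-≤ (f≤g x) (sum-map-mono-≤ xs f≤g)

  sum-map-Σ< : ∀ (xs : List A) M (h : A → ℕ → ℕ) →
               sum (map (λ x → Σ< M (h x)) xs) ≡ Σ< M (λ t → sum (map (λ x → h x t) xs))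
  sum-map-Σ< []       M h = sym (Σ<-zero M)
  sum-map-Σ< (x ∷ xs) M h = trans (cong (Σ< M (h x) +_) (sum-map-Σ< xs M h))
                                  (sym (Σ<-distrib-+ M (h x) (λ t → sum (map (λ y → h y t) xs))))

Σ[]-suc : ∀ m (f : Fin (suc m) → ℕ) → Σ[ suc m ] f ≡ f Fin.zero + Σ[ m ] (f ∘ Fin.suc)
Σ[]-suc m f = cong (f Fin.zero +_) (cong sum (trans (map-tabulate Fin.suc f)
                                                    (sym (map-tabulate (λ i → i) (f ∘ Fin.suc)))))

isJob-sound : ∀ {m} {x : Maybe (Fin m)} {j} → isJob x j ≡ true → x ≡ just j
isJob-sound {x = just k} eq = cong just (toWitness (Equivalence.from T-≡ eq))

isJob-self : ∀ {m} (j : Fin m) → isJob (just j) j ≡ true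
isJob-self j = trans (isYes≗does (j Fin.≟ j)) (dec-true (j Fin.≟ j) refl)

busy : ∀ {A : Set} → Maybe A → ℕ
busy nothing  = 0
busy (just _) = 1

busy≤1 : ∀ {A : Set} (x : Maybe A) → busy x ≤ 1
busy≤1 nothing  = z≤n
busy≤1 (just _) = ≤-refl

busy≡1⊎idle : ∀ {A : Set} (x : Maybe A) → busy x ≡ 1 ⊎ x ≡ nothing
busy≡1⊎idle nothing  = inj₂ refl
busy≡1⊎idle (just _) = inj₁ refl

jobIndicator : ∀ {m} → Maybe (Fin m) → Fin m → ℕ
jobIndicator x i = if isJob x i then 1 else 0

Σ-jobIndicator-just : ∀ {m} (j : Fin m) → Σ[ m ] (jobIndicator (just j)) ≡ 1
Σ-jobIndicator-just {suc m} Fin.zero    =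
  trans (Σ[]-suc m (jobIndicator (just Fin.zero))) (cong suc (sum-map-zero (allFin m)))
Σ-jobIndicator-just {suc m} (Fin.suc j) =
  trans (Σ[]-suc m (jobIndicator (just (Fin.suc j))))
        (trans (cong sum (map-cong shift (allFin m))) (Σ-jobIndicator-just j))
  where
  shift : ∀ i → jobIndicator (just (Fin.suc j)) (Fin.suc i) ≡ jobIndicator (just j) i
  shift i = cong (if_then 1 else 0) (⌊⌋-map′ _ _ (j Fin.≟ i))

Σ-jobIndicator : ∀ {m} (x : Maybe (Fin m)) → Σ[ m ] (jobIndicator x) ≡ busy x
Σ-jobIndicator {m} nothing  = sum-map-zero (allFin m)
Σ-jobIndicator     (just j) = Σ-jobIndicator-just j

search-sound : ∀ (P : ℕ → Bool) from fuel {t} → from ≤ t → t < from + fuel → T (P t) →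
               T (P (search P from fuel)) × search P from fuel < from + fuel
search-sound P from zero {t} from≤t t<from _ =
  ⊥-elim (<⇒≱ (subst (t <_) (+-identityʳ from) t<from) from≤t)
search-sound P from (suc fuel) {t} from≤t t<bound Pt with P from in Pfrom
... | true  = Equivalence.from T-≡ Pfrom , m<m+n from z<s
... | false with m≤n⇒m<n∨m≡n from≤t
...   | inj₂ refl   = ⊥-elim (subst T Pfrom Pt)
...   | inj₁ from<t with search-sound P (suc from) fuel from<t (subst (t <_) (+-suc from fuel) t<bound) Pt
...     | found , bound = found , subst (search P (suc from) fuel <_) (sym (+-suc from fuel)) bound

module _ {I : Instance} (X : Schedule I) (i : Fin (n I)) where

  done : ℕ → ℕ
  done = count (slot X) i

  done-≤-suc : ∀ t → done t ≤ done (suc t)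
  done-≤-suc t = m≤m+n (done t) _

  done-mono : ∀ {t u} → t ≤ u → done t ≤ done u
  done-mono {u = zero}  z≤n = ≤-refl
  done-mono {u = suc u} t≤u with m≤n⇒m<n∨m≡n t≤u
  ... | inj₁ (s≤s t≤u') = ≤-trans (done-mono t≤u') (done-≤-suc u)
  ... | inj₂ refl       = ≤-refl

  done-idle : ∀ {t} → slot X t ≡ nothing → done (suc t) ≡ done t
  done-idle {t} idle rewrite idle = +-identityʳ (done t)

  done-busy : ∀ {t} → slot X t ≡ just i → done (suc t) ≡ suc (done t)
  done-busy {t} slot≡ rewrite slot≡ | isJob-self i = +-comm (done t) 1

  done≤∸release : ∀ t → done t ≤ t ∸ r I i
  done≤∸release zero = z≤n
  done≤∸release (suc t) with isJob (slot X t) i in isI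
  ... | true = begin
    done t + 1      ≡⟨ +-comm (done t) 1 ⟩
    suc (done t)    ≤⟨ s≤s (done≤∸release t) ⟩
    suc (t ∸ r I i) ≡⟨ +-∸-assoc 1 (released X t i (isJob-sound isI)) ⟨
    suc t ∸ r I i   ∎
    where open ≤-Reasoning
  ... | false = begin
    done t + 0    ≡⟨ +-identityʳ (done t) ⟩
    done t        ≤⟨ done≤∸release t ⟩
    t ∸ r I i     ≤⟨ ∸-monoˡ-≤ (r I i) (n≤1+n t) ⟩
    suc t ∸ r I i ∎
    where open ≤-Reasoning

  done-horizon : ∀ {t} → horizon X ≤ t → done t ≡ p I i
  done-horizon {t} h≤t with m≤n⇒m<n∨m≡n h≤t
  ... | inj₂ h≡t = subst (λ u → done u ≡ p I i) h≡t (exact X i)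
  done-horizon {suc t} _ | inj₁ (s≤s h≤t) = trans (done-idle (idleAfter X t h≤t)) (done-horizon h≤t)

  done≤p : ∀ t → done t ≤ p I i
  done≤p t = ≤-trans (done-mono (m≤m+n t (horizon X))) (≤-reflexive (done-horizon (m≤n+m (horizon X) t)))

  done-reaches : ∀ t {k} → 1 ≤ k → k ≤ done t → ∃[ u ] u < t × slot X u ≡ just i × suc (done u) ≡ k
  done-reaches zero    1≤k k≤0 = contradiction (≤-trans 1≤k k≤0) λ ()
  done-reaches (suc t) {k} 1≤k k≤done with k ≤? done t
  ... | yes k≤done' with done-reaches t 1≤k k≤done'
  ...   | u , u<t , slot≡ , done≡ = u , m<n⇒m<1+n u<t , slot≡ , done≡
  done-reaches (suc t) {k} 1≤k k≤done | no k≰done' with isJob (slot X t) i in isI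
  ...   | true  = t , ≤-refl , isJob-sound isI ,
                  ≤-antisym (≰⇒> k≰done') (≤-trans k≤done (≤-reflexive (+-comm (done t) 1)))
  ...   | false = contradiction (≤-trans k≤done (≤-reflexive (+-identityʳ (done t)))) k≰done'

  isKthSlot : ℕ → ℕ → Bool
  isKthSlot k t = isJob (slot X t) i ∧ (suc (done t) ≡ᵇ k)

  T-isKthSlot : ∀ k t → T (isKthSlot k t) ⇔ (slot X t ≡ just i × suc (done t) ≡ k)
  T-isKthSlot k t = mk⇔ sound complete
    where
    sound : T (isKthSlot k t) → slot X t ≡ just i × suc (done t) ≡ k
    sound h with Equivalence.to T-∧ h
    ... | isI , isK = isJob-sound (Equivalence.to T-≡ isI) , ≡ᵇ⇒≡ _ _ isK
    complete : slot X t ≡ just i × suc (done t) ≡ k → T (isKthSlot k t)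
    complete (slot≡ , done≡) = Equivalence.from T-∧
      ( Equivalence.from T-≡ (trans (cong (λ x → isJob x i) slot≡) (isJob-self i))
      , ≡⇒≡ᵇ _ _ done≡ )

  kthSlot-spec : ∀ {k} → 1 ≤ k → k ≤ p I i →
                 slot X (kthSlot X i k) ≡ just i × suc (done (kthSlot X i k)) ≡ k × kthSlot X i k < horizon X
  kthSlot-spec {k} 1≤k k≤p
    with done-reaches (horizon X) 1≤k (≤-trans k≤p (≤-reflexive (sym (done-horizon ≤-refl))))
  ... | u , u<h , isKth
    with search-sound (isKthSlot k) 0 (horizon X) z≤n u<h (Equivalence.from (T-isKthSlot k u) isKth)
  ...   | found , bound with Equivalence.to (T-isKthSlot k _) found
  ...     | slot≡ , done≡ = slot≡ , done≡ , bound

  slot-kthSlot : ∀ {k} → 1 ≤ k → k ≤ p I i → slot X (kthSlot X i k) ≡ just i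
  slot-kthSlot 1≤k k≤p = proj₁ (kthSlot-spec 1≤k k≤p)

  done-kthSlot : ∀ {k} → 1 ≤ k → k ≤ p I i → suc (done (kthSlot X i k)) ≡ k
  done-kthSlot 1≤k k≤p = proj₁ (proj₂ (kthSlot-spec 1≤k k≤p))

  kthSlot<horizon : ∀ {k} → 1 ≤ k → k ≤ p I i → kthSlot X i k < horizon X
  kthSlot<horizon 1≤k k≤p = proj₂ (proj₂ (kthSlot-spec 1≤k k≤p))

  done-c_ik : ∀ {k} → 1 ≤ k → k ≤ p I i → done (c_ik X i k) ≡ k
  done-c_ik 1≤k k≤p = trans (done-busy (slot-kthSlot 1≤k k≤p)) (done-kthSlot 1≤k k≤p)

  release≤c_ik : ∀ {k} → 1 ≤ k → k ≤ p I i → r I i ≤ c_ik X i k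
  release≤c_ik 1≤k k≤p = m≤n⇒m≤1+n (released X _ i (slot-kthSlot 1≤k k≤p))

  kthSlot-mono : ∀ {k k′} → 1 ≤ k → k ≤ k′ → k′ ≤ p I i → kthSlot X i k ≤ kthSlot X i k′
  kthSlot-mono {k} {k′} 1≤k k≤k′ k′≤p = ≮⇒≥ λ t′<t → n≮n (done (kthSlot X i k)) (begin-strict
    done (kthSlot X i k)       <⟨ n<1+n _ ⟩
    suc (done (kthSlot X i k)) ≡⟨ done-kthSlot 1≤k (≤-trans k≤k′ k′≤p) ⟩
    k                          ≤⟨ k≤k′ ⟩
    k′                         ≡⟨ done-c_ik (≤-trans 1≤k k≤k′) k′≤p ⟨
    done (c_ik X i k′)         ≤⟨ done-mono t′<t ⟩
    done (kthSlot X i k)       ∎)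
    where open ≤-Reasoning

  f_ik≤f_i : ∀ {k} → 1 ≤ k → k ≤ p I i → f_ik X i k ≤ f_i X i
  f_ik≤f_i 1≤k k≤p = ∸-monoˡ-≤ (r I i) (s≤s (kthSlot-mono 1≤k k≤p ≤-refl))

  p≤f_i : p I i ≤ f_i X i
  p≤f_i = subst (_≤ f_i X i) (done-c_ik (p≥1 I i) ≤-refl) (done≤∸release (c_i X i))

  done-completed : ∀ {t} → c_i X i ≤ t → done t ≡ p I i
  done-completed {t} c≤t =
    ≤-antisym (done≤p t) (≤-trans (≤-reflexive (sym (done-c_ik (p≥1 I i) ≤-refl))) (done-mono c≤t))

  pending≡before-c_ik : ∀ {k} → 1 ≤ k → k ≤ p I i → ∀ t → 𝟙< (done t) k ≡ 𝟙< t (c_ik X i k)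
  pending≡before-c_ik {k} 1≤k k≤p t with t ≤? kthSlot X i k
  ... | yes t≤tₖ = trans (𝟙<-≡1 (≤-trans (s≤s (done-mono t≤tₖ)) (≤-reflexive (done-kthSlot 1≤k k≤p))))
                         (sym (𝟙<-≡1 (s≤s t≤tₖ)))
  ... | no t≰tₖ = trans (𝟙<-≡0 (≤-trans (≤-reflexive (sym (done-c_ik 1≤k k≤p))) (done-mono (≰⇒> t≰tₖ))))
                        (sym (𝟙<-≡0 (≰⇒> t≰tₖ)))

  Σ₁-c_ik≡Σ<-remaining : ∀ M → horizon X ≤ M → Σ₁ (p I i) (c_ik X i) ≡ Σ< M (λ t → p I i ∸ done t)
  Σ₁-c_ik≡Σ<-remaining M h≤M = begin
    Σ₁ (p I i) (c_ik X i)
      ≡⟨ Σ₁-cong (p I i) c≡Σ<𝟙< ⟩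
    Σ₁ (p I i) (λ k → Σ< M (λ t → 𝟙< t (c_ik X i k)))
      ≡⟨ Σ₁-cong (p I i) (λ 1≤k k≤p → Σ<-cong M (λ t → sym (pending≡before-c_ik 1≤k k≤p t))) ⟩
    Σ₁ (p I i) (λ k → Σ< M (λ t → 𝟙< (done t) k))
      ≡⟨ Σ₁-Σ< (p I i) M (λ k t → 𝟙< (done t) k) ⟩
    Σ< M (λ t → Σ₁ (p I i) (𝟙< (done t)))
      ≡⟨ Σ<-cong M (λ t → Σ₁-𝟙< (p I i) (done t)) ⟩
    Σ< M (λ t → p I i ∸ done t)
      ∎
    where
    open ≡-Reasoning
    c≡Σ<𝟙< : ∀ {k} → 1 ≤ k → k ≤ p I i → c_ik X i k ≡ Σ< M (λ t → 𝟙< t (c_ik X i k))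
    c≡Σ<𝟙< 1≤k k≤p = sym (trans (Σ<-𝟙< M _) (m≥n⇒m⊓n≡n c≤M))
      where c≤M = ≤-trans (kthSlot<horizon 1≤k k≤p) h≤M

module _ {I : Instance} where

  totalDone : Schedule I → ℕ → ℕ
  totalDone X t = Σ[ n I ] (λ i → done X i t)

  totalLeft : Schedule I → ℕ → ℕ
  totalLeft X t = Σ[ n I ] (λ i → p I i ∸ done X i t)

  sumUnitCompletion : Schedule I → ℕ
  sumUnitCompletion X = Σ[ n I ] (λ i → Σ₁ (p I i) (c_ik X i))

  totalDone-suc : ∀ (X : Schedule I) t → totalDone X (suc t) ≡ totalDone X t + busy (slot X t)
  totalDone-suc X t = trans (sum-map-distrib-+ (allFin (n I)) (λ i → done X i t) (jobIndicator (slot X t)))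
                            (cong (totalDone X t +_) (Σ-jobIndicator (slot X t)))

  idle⇒done-max : ∀ (S : Schedule I) → WorkConserving S → ∀ {t} → slot S t ≡ nothing →
                  ∀ (O : Schedule I) i → done O i (suc t) ≤ done S i (suc t)
  idle⇒done-max S wc {t} idle O i with r I i ≤? t
  ... | yes r≤t = begin
    done O i (suc t) ≤⟨ done≤p O i (suc t) ⟩
    p I i            ≡⟨ done-completed S i (≮⇒≥ λ t<c → wc t (i , r≤t , t<c) idle) ⟨
    done S i t       ≤⟨ done-≤-suc S i t ⟩
    done S i (suc t) ∎
    where open ≤-Reasoning
  ... | no r≰t = begin
    done O i (suc t) ≤⟨ done≤∸release O i (suc t) ⟩
    suc t ∸ r I i    ≡⟨ m≤n⇒m∸n≡0 (≰⇒> r≰t) ⟩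
    0                ≤⟨ z≤n ⟩
    done S i (suc t) ∎
    where open ≤-Reasoning

  totalDone-max : ∀ (S : Schedule I) → WorkConserving S → ∀ (O : Schedule I) t → totalDone O t ≤ totalDone S t
  totalDone-max S wc O zero = sum-map-mono-≤ (allFin (n I)) (λ _ → z≤n)
  totalDone-max S wc O (suc t) with busy≡1⊎idle (slot S t)
  ... | inj₁ busyₜ = begin
    totalDone O (suc t)             ≡⟨ totalDone-suc O t ⟩
    totalDone O t + busy (slot O t) ≤⟨ +-mono-≤ (totalDone-max S wc O t) (busy≤1 (slot O t)) ⟩
    totalDone S t + 1               ≡⟨ cong (totalDone S t +_) busyₜ ⟨
    totalDone S t + busy (slot S t) ≡⟨ totalDone-suc S t ⟨
    totalDone S (suc t)             ∎
    where open ≤-Reasoning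
  ... | inj₂ idle = sum-map-mono-≤ (allFin (n I)) (idle⇒done-max S wc idle O)

  totalLeft+totalDone : ∀ (X : Schedule I) t → totalLeft X t + totalDone X t ≡ Σ[ n I ] (p I)
  totalLeft+totalDone X t =
    trans (sym (sum-map-distrib-+ (allFin (n I)) (λ i → p I i ∸ done X i t) (λ i → done X i t)))
          (cong sum (map-cong (λ i → m∸n+n≡m (done≤p X i t)) (allFin (n I))))

  totalLeft-min : ∀ (S : Schedule I) → WorkConserving S → ∀ (O : Schedule I) t → totalLeft S t ≤ totalLeft O t
  totalLeft-min S wc O t = +-cancelʳ-≤ (totalDone S t) (totalLeft S t) (totalLeft O t) (begin
    totalLeft S t + totalDone S t ≡⟨ totalLeft+totalDone S t ⟩
    Σ[ n I ] (p I)                ≡⟨ totalLeft+totalDone O t ⟨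
    totalLeft O t + totalDone O t ≤⟨ +-monoʳ-≤ (totalLeft O t) (totalDone-max S wc O t) ⟩
    totalLeft O t + totalDone S t ∎)
    where open ≤-Reasoning

  sumUnitCompletion≡Σ<-totalLeft : ∀ (X : Schedule I) M → horizon X ≤ M → sumUnitCompletion X ≡ Σ< M (totalLeft X)
  sumUnitCompletion≡Σ<-totalLeft X M h≤M =
    trans (cong sum (map-cong (λ i → Σ₁-c_ik≡Σ<-remaining X i M h≤M) (allFin (n I))))
          (sum-map-Σ< (allFin (n I)) M (λ i t → p I i ∸ done X i t))

  sumUnitFlow+Σpr≡sumUnitCompletion : ∀ (X : Schedule I) → sumUnitFlow X + Σ[ n I ] (λ i → p I i * r I i) ≡ sumUnitCompletion X
  sumUnitFlow+Σpr≡sumUnitCompletion X =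
    trans (sym (sum-map-distrib-+ (allFin (n I)) (λ i → Σ₁ (p I i) (f_ik X i)) (λ i → p I i * r I i)))
          (cong sum (map-cong (λ i → Σ₁-∸+ (p I i) (c_ik X i) (r I i) (release≤c_ik X i)) (allFin (n I))))

  sumUnitFlow-min : ∀ (S : Schedule I) → WorkConserving S → ∀ (O : Schedule I) → sumUnitFlow S ≤ sumUnitFlow O
  sumUnitFlow-min S wc O = +-cancelʳ-≤ Σpr (sumUnitFlow S) (sumUnitFlow O) (begin
    sumUnitFlow S + Σpr  ≡⟨ sumUnitFlow+Σpr≡sumUnitCompletion S ⟩
    sumUnitCompletion S  ≡⟨ sumUnitCompletion≡Σ<-totalLeft S M (m≤m+n (horizon S) (horizon O)) ⟩
    Σ< M (totalLeft S)   ≤⟨ Σ<-mono-≤ M (totalLeft-min S wc O) ⟩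
    Σ< M (totalLeft O)   ≡⟨ sumUnitCompletion≡Σ<-totalLeft O M (m≤n+m (horizon O) (horizon S)) ⟨
    sumUnitCompletion O  ≡⟨ sumUnitFlow+Σpr≡sumUnitCompletion O ⟨
    sumUnitFlow O + Σpr  ∎)
    where
    open ≤-Reasoning
    Σpr = Σ[ n I ] (λ i → p I i * r I i)
    M   = horizon S + horizon O

  sumUnitFlow≤F : ∀ (X : Schedule I) → sumUnitFlow X ≤ F X
  sumUnitFlow≤F X = sum-map-mono-≤ (allFin (n I)) λ i → begin
    Σ₁ (p I i) (f_ik X i)        ≤⟨ Σ₁-mono-≤ (p I i) (f_ik≤f_i X i) ⟩
    Σ₁ (p I i) (λ _ → f_i X i)   ≡⟨ Σ₁-const (p I i) (f_i X i) ⟩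
    p I i * f_i X i              ≤⟨ *-monoˡ-≤ (f_i X i) (p≤f_i X i) ⟩
    f_i X i * f_i X i            ∎
    where open ≤-Reasoning

lemmaD5 : (I : Instance) (S : Schedule I) → WorkConserving S →
    (O : Schedule I) → IsOptimal O → sumUnitFlow S ≤ F O
lemmaD5 I S wc O _ = ≤-trans (sumUnitFlow-min S wc O) (sumUnitFlow≤F O)
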